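{- Let $G$ be a connected graph with at least three vertices, let $H$ be a square root of $G$, and let $S\subseteq V(G)$ be such that $H-S$ is isomorphic to $pK_1+qK_2$ for some $p,q$. Then every two distinct $S$-isolated vertices of $H$ that have the same neighbors in $S$ are true twins in $G$.
   Context: Graphs are finite, simple, undirected. $H$ is a square root of $G$ if $V(H)=V(G)$ and two distinct vertices are adjacent in $G$ iff their distance in $H$ is at most two. $pK_1+qK_2$ is the disjoint union of $p$ isolated vertices and $q$ disjoint edges. The $S$-isolated vertices are the vertices of $V(H)\setminus S$ that are isolated in $H-S$. Vertices $u,v$ are true twins in $G$ if $N_G[u]=N_G[v]$. -}

module Defs where

open import Level using (0ℓ)
open import Data.Nat using (ℕ)
open import Data.Fin using (Fin)
open import Data.Fin.Subset using (Subset; _∈_; _∉_)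
open import Data.Bool using (Bool)
open import Data.Product using (Σ; ∃; _×_; _,_; proj₁)
open import Data.Sum using (_⊎_; inj₁; inj₂)
open import Data.Empty using (⊥)
open import Relation.Nullary using (¬_)
open import Relation.Binary.PropositionalEquality using (_≡_; _≢_)
open import Function.Bundles using (_⇔_; _⤖_; Bijection)

record Graph (n : ℕ) : Set₁ where
  field
    Adj    : Fin n → Fin n → Set
    sym    : ∀ {u v} → Adj u v → Adj v u
    irrefl : ∀ {u} → ¬ Adj u u
open Graph public

data Reach {n : ℕ} (G : Graph n) : Fin n → Fin n → Set where
  here : ∀ {u} → Reach G u u
  step : ∀ {u v w} → Adj G u v → Reach G v w → Reach G u w

Connected : ∀ {n} → Graph n → Set
Connected G = ∀ u v → Reach G u v

DistLe2 : ∀ {n} → Graph n → Fin n → Fin n → Set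
DistLe2 H u v = Adj H u v ⊎ (∃ λ w → Adj H u w × Adj H w v)

IsSquareRoot : ∀ {n} → Graph n → Graph n → Set
IsSquareRoot H G = ∀ u v → u ≢ v → (Adj G u v ⇔ DistLe2 H u v)

VminusS : ∀ {n} → Subset n → Set
VminusS {n} S = Σ (Fin n) (λ v → v ∉ S)

-- the graph pK1 + qK2, vertex set Fin p ⊎ (Fin q × Bool):
-- the inj₁ vertices are isolated, (i , b) and (i , c) with b ≠ c form an edge.
AdjpK1qK2 : (p q : ℕ) → (Fin p ⊎ (Fin q × Bool)) → (Fin p ⊎ (Fin q × Bool)) → Set
AdjpK1qK2 p q (inj₂ (i , b)) (inj₂ (j , c)) = (i ≡ j) × (b ≢ c)
AdjpK1qK2 p q _ _ = ⊥

MinusIsoPK1QK2 : ∀ {n} → Graph n → Subset n → ℕ → ℕ → Set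
MinusIsoPK1QK2 H S p q =
  Σ (VminusS S ⤖ (Fin p ⊎ (Fin q × Bool))) λ f →
    ∀ x y → (Adj H (proj₁ x) (proj₁ y) ⇔ AdjpK1qK2 p q (Bijection.to f x) (Bijection.to f y))

SIsolated : ∀ {n} → Graph n → Subset n → Fin n → Set
SIsolated H S v = v ∉ S × (∀ w → w ∉ S → ¬ Adj H v w)

SameNbrsIn : ∀ {n} → Graph n → Subset n → Fin n → Fin n → Set
SameNbrsIn H S u v = ∀ s → s ∈ S → (Adj H u s ⇔ Adj H v s)

InClosedNbhd : ∀ {n} → Graph n → Fin n → Fin n → Set
InClosedNbhd G u w = (w ≡ u) ⊎ Adj G u w

TrueTwins : ∀ {n} → Graph n → Fin n → Fin n → Set
TrueTwins G u v = ∀ w → (InClosedNbhd G u w ⇔ InClosedNbhd G v w)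

-- An S-isolated vertex has all its H-neighbours in S, so two S-isolated vertices with the same
-- neighbours in S have the same H-neighbourhood. Connectivity gives u an H-neighbour, which is
-- then a common neighbour, so u and v are adjacent in G; and every H-path of length at most two
-- leaving u can be re-routed to leave v instead, so N_G[u] = N_G[v].
module Submission where

open import Defs
open import Data.Nat using (ℕ; _≤_)
open import Data.Fin using (Fin; _≟_)
open import Data.Fin.Subset using (Subset)
open import Data.Fin.Subset.Properties using (_∈?_)
open import Data.Product using (∃; _,_)
open import Data.Sum using (inj₁; inj₂)
open import Data.Empty using (⊥-elim)
open import Relation.Nullary using (yes; no)
open import Relation.Binary.PropositionalEquality using (_≢_; refl; ≢-sym)
open import Function.Bundles using (Equivalence; mk⇔)

NbrsSubset : ∀ {n} → Graph n → Fin n → Fin n → Set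
NbrsSubset H u v = ∀ x → Adj H u x → Adj H v x

HasNbr : ∀ {n} → Graph n → Fin n → Set
HasNbr H u = ∃ λ x → Adj H u x

module _ {n : ℕ} {G H : Graph n} (root : IsSquareRoot H G) where

  adj⇒≢ : ∀ {u w} → Adj G u w → u ≢ w
  adj⇒≢ a refl = irrefl G a

  adj⇒distLe2 : ∀ {u w} → Adj G u w → DistLe2 H u w
  adj⇒distLe2 {u} {w} a = Equivalence.to (root u w (adj⇒≢ a)) a

  distLe2⇒adj : ∀ {u w} → u ≢ w → DistLe2 H u w → Adj G u w
  distLe2⇒adj {u} {w} u≢w = Equivalence.from (root u w u≢w)

  adj⇒hasNbr : ∀ {u w} → Adj G u w → HasNbr H u
  adj⇒hasNbr a with adj⇒distLe2 a
  ... | inj₁ h           = _ , h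
  ... | inj₂ (x , h , _) = x , h

  connected⇒hasNbr : Connected G → ∀ {u v} → u ≢ v → HasNbr H u
  connected⇒hasNbr conn {u} {v} u≢v with conn u v
  ... | here     = ⊥-elim (u≢v refl)
  ... | step a _ = adj⇒hasNbr a

  distLe2-reroute : ∀ {u v w} → NbrsSubset H u v → DistLe2 H u w → DistLe2 H v w
  distLe2-reroute ⊆ (inj₁ h)           = inj₁ (⊆ _ h)
  distLe2-reroute ⊆ (inj₂ (x , h , k)) = inj₂ (x , ⊆ x h , k)

  nbrsSubset⇒adj : ∀ {u v} → v ≢ u → NbrsSubset H u v → HasNbr H u → Adj G v u
  nbrsSubset⇒adj v≢u ⊆ (x , h) = distLe2⇒adj v≢u (inj₂ (x , ⊆ x h , Graph.sym H h))

  nbrsSubset⇒closedNbhd⊆ : ∀ {u v} → u ≢ v → NbrsSubset H u v → HasNbr H u →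
                           ∀ w → InClosedNbhd G u w → InClosedNbhd G v w
  nbrsSubset⇒closedNbhd⊆ u≢v ⊆ nbr w (inj₁ refl) = inj₂ (nbrsSubset⇒adj (≢-sym u≢v) ⊆ nbr)
  nbrsSubset⇒closedNbhd⊆ {v = v} u≢v ⊆ nbr w (inj₂ a) with w ≟ v
  ... | yes w≡v = inj₁ w≡v
  ... | no  w≢v = inj₂ (distLe2⇒adj (≢-sym w≢v) (distLe2-reroute ⊆ (adj⇒distLe2 a)))

sIsolated⇒nbrsSubset : ∀ {n} (H : Graph n) {S u v} →
                       SIsolated H S u → SameNbrsIn H S u v → NbrsSubset H u v
sIsolated⇒nbrsSubset H {S} (_ , noOutside) same x h with x ∈? S
... | yes x∈S = Equivalence.to (same x x∈S) h
... | no  x∉S = ⊥-elim (noOutside x x∉S h)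

sameNbrsIn-sym : ∀ {n} (H : Graph n) {S u v} → SameNbrsIn H S u v → SameNbrsIn H S v u
sameNbrsIn-sym H same s s∈S = mk⇔ (Equivalence.from (same s s∈S)) (Equivalence.to (same s s∈S))

mainTheorem12 : (n : ℕ) → 3 ≤ n → (G H : Graph n) → Connected G → IsSquareRoot H G →
                (S : Subset n) → (p q : ℕ) → MinusIsoPK1QK2 H S p q →
                (u v : Fin n) → u ≢ v → SIsolated H S u → SIsolated H S v →
                SameNbrsIn H S u v → TrueTwins G u v
mainTheorem12 n _ G H conn root S p q _ u v u≢v isoU isoV same w =
  mk⇔ (closedNbhd⊆ u≢v isoU same w) (closedNbhd⊆ (≢-sym u≢v) isoV (sameNbrsIn-sym H same) w)
  where
  closedNbhd⊆ : ∀ {x y} → x ≢ y → SIsolated H S x → SameNbrsIn H S x y →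
                ∀ z → InClosedNbhd G x z → InClosedNbhd G y z
  closedNbhd⊆ x≢y isoX sameXY =
    nbrsSubset⇒closedNbhd⊆ {G = G} {H} root x≢y (sIsolated⇒nbrsSubset H isoX sameXY)
                                           (connected⇒hasNbr {G = G} {H} root conn x≢y)
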